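{- Let $p,q$ be distinct primes, $n,m$ positive integers, and $G=\mathrm{El}(p^n)\times\mathrm{El}(q^m)$. Define $V_1=\{(e,e)\}$, $V_2=\{(a,e): a\in \mathrm{El}(p^n)\setminus\{e\}\}$, $V_3=\{(a,b): a\in\mathrm{El}(p^n)\setminus\{e\},\ b\in\mathrm{El}(q^m)\setminus\{e\}\}$ and $V_4=\{(e,b): b\in\mathrm{El}(q^m)\setminus\{e\}\}$. Then $\{V_1,V_2,V_3,V_4\}$ is an equitable partition of the enhanced power graph $\mathcal{G}_E(G)$.
   Context: $\mathrm{El}(p^n)$ denotes the elementary abelian group of order $p^n$; $e$ denotes the identity element. For a group $G$, the enhanced power graph $\mathcal{G}_E(G)$ is the simple graph with vertex set $G$ in which distinct $a,b$ are adjacent if and only if $a,b\in\langle c\rangle$ for some $c\in G$. A partition $\{V_1,\dots,V_r\}$ of the vertex set of a graph is equitable if for every $i,j$ and all $u,v\in V_i$ one has $|N(u)\cap V_j|=|N(v)\cap V_j|$, where $N(u)$ is the set of neighbours of $u$. -}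

module Defs where

open import Data.Nat using (ℕ; zero; suc; _+_; NonZero)
open import Data.Nat.DivMod using (_%_; m%n<n)
open import Data.Nat.Primality using (Prime; prime⇒nonZero)
open import Data.Fin using (Fin; toℕ; fromℕ<) renaming (zero to fz; suc to fs)
open import Data.Vec using (Vec; zipWith; replicate)
open import Data.Product using (Σ; ∃; _×_; _,_)
open import Data.List using (List; length)
open import Data.List.Membership.Propositional using (_∈_)
open import Data.List.Relation.Unary.Unique.Propositional using (Unique)
open import Relation.Binary.PropositionalEquality using (_≡_; _≢_)
open import Relation.Nullary using (¬_)
open import Function.Bundles using (_⇔_)

_+ₚ_ : ∀ {p} .{{_ : NonZero p}} → Fin p → Fin p → Fin p
_+ₚ_ {p} x y = fromℕ< (m%n<n (toℕ x + toℕ y) p)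

zeroₚ : ∀ {p} .{{_ : NonZero p}} → Fin p
zeroₚ {p} = fromℕ< (m%n<n 0 p)

-- The elementary abelian group El(p^n) = (ℤ/pℤ)^n (for p prime),
-- with componentwise addition.
El : ℕ → ℕ → Set
El p n = Vec (Fin p) n

elAdd : ∀ {p n} → Prime p → El p n → El p n → El p n
elAdd pr = zipWith (λ x y → _+ₚ_ {{prime⇒nonZero pr}} x y)

elId : ∀ {p n} → Prime p → El p n
elId {n = n} pr = replicate n (zeroₚ {{prime⇒nonZero pr}})

G : (p n q m : ℕ) → Set
G p n q m = El p n × El q m

module _ {p n q m : ℕ} (pp : Prime p) (pq : Prime q) where

  e : G p n q m
  e = elId pp , elId pq

  _·_ : G p n q m → G p n q m → G p n q m
  (a , b) · (c , d) = elAdd pp a c , elAdd pq b d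

  pow : G p n q m → ℕ → G p n q m
  pow g zero    = e
  pow g (suc k) = g · pow g k

  -- x ∈ ⟨c⟩ (in a finite group the cyclic subgroup generated by c
  -- is the set of non-negative powers of c)
  InCyclic : G p n q m → G p n q m → Set
  InCyclic x c = ∃ λ k → pow c k ≡ x

  Adj : G p n q m → G p n q m → Set
  Adj a b = a ≢ b × ∃ λ c → InCyclic a c × InCyclic b c

  V : Fin 4 → G p n q m → Set
  V fz                (a , b) = a ≡ elId pp × b ≡ elId pq
  V (fs fz)           (a , b) = a ≢ elId pp × b ≡ elId pq
  V (fs (fs fz))      (a , b) = a ≢ elId pp × b ≢ elId pq
  V (fs (fs (fs fz))) (a , b) = a ≡ elId pp × b ≢ elId pq

HasSize : {A : Set} → (A → Set) → ℕ → Set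
HasSize {A} P k = Σ (List A) λ xs → Unique xs × (∀ x → (x ∈ xs) ⇔ P x) × length xs ≡ k

IsPartition : {A : Set} {r : ℕ} → (Fin r → A → Set) → Set
IsPartition {A} {r} W =
  (∀ i → ∃ λ x → W i x) ×
  (∀ x → ∃ λ i → W i x) ×
  (∀ i j x → W i x → W j x → i ≡ j)

IsEquitable : {A : Set} {r : ℕ} → (A → A → Set) → (Fin r → A → Set) → Set
IsEquitable {A} {r} Adj W =
  IsPartition W ×
  (∀ i j u v → W i u → W i v →
     ∃ λ k → HasSize (λ w → Adj u w × W j w) k × HasSize (λ w → Adj v w × W j w) k)

module Submission where

-- In El(p^n) = (ℤ/p)^n the cyclic subgroup generated by y is the line {k • y}, so a and x
-- lie in a common cyclic subgroup iff a = 0 or x lies on the line through a. Since p ≠ q, the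
-- Chinese remainder theorem makes (a , b) and (x , y) adjacent in 𝒢_E(G) iff they are distinct,
-- a, x lie in a common cyclic subgroup and so do b, y. If u = (a , b) and v = (a′ , b′) lie in
-- the same part, then a, a′ are both zero or both nonzero, and likewise b, b′; mapping k • a to
-- k • a′ in the first coordinate and k • b to k • b′ in the second is then a bijection from the
-- neighbours of u onto those of v that preserves every part.

open import Defs
open import Data.Bool using (Bool; true; false)
open import Data.Empty using (⊥-elim)
open import Data.Fin using (Fin; toℕ; fromℕ<) renaming (zero to fz; suc to fs)
open import Data.Fin.Properties using (toℕ-fromℕ<; fromℕ<-cong; fromℕ<-injective; fromℕ<-toℕ; toℕ<n; any?)
  renaming (_≟_ to _≟ᶠ_)
open import Data.List
  using (List; []; _∷_; length; filter; deduplicate; allFin; cartesianProduct; cartesianProductWith)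
import Data.List as List
open import Data.List.Properties using (length-map; map-∘; map-id-local)
open import Data.List.Membership.Propositional using (_∈_)
open import Data.List.Membership.Propositional.Properties
  using (∈-filter⁺; ∈-filter⁻; ∈-deduplicate⁺; ∈-deduplicate⁻; ∈-map⁺; ∈-map⁻; ∈-allFin;
         ∈-cartesianProduct⁺; ∈-cartesianProductWith⁺)
import Data.List.Relation.Unary.All as All
open import Data.List.Relation.Unary.Any using (here)
open import Data.List.Relation.Unary.Unique.Propositional using (Unique)
open import Data.List.Relation.Unary.Unique.Propositional.Properties using (map⁻)
open import Data.List.Relation.Unary.Unique.DecPropositional.Properties using (deduplicate-!)
open import Relation.Unary using (Decidable)
open import Data.Nat using (ℕ; zero; suc; _+_; _*_; _≤_; _<_; NonZero; s≤s; z≤n; nonTrivial⇒n>1)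
open import Data.Nat.Coprimality using (Coprime; coprime-Bézout) renaming (sym to coprime-sym)
open import Data.Nat.DivMod
  using (_%_; m%n<n; m%n%n≡m%n; %-distribˡ-+; %-distribˡ-*; [m+kn]%n≡m%n; m<n⇒m%n≡m; m*n%n≡0)
open import Data.Nat.Divisibility using (n∣m⇒m%n≡0)
open import Data.Nat.GCD using (module Bézout)
open import Data.Nat.Primality using (Prime; prime⇒nonZero; prime⇒nonTrivial; prime⇒irreducible)
open import Data.Nat.Properties using (*-comm; *-assoc; *-identityˡ; *-identityʳ; +-comm; <-irrefl)
open import Data.Nat.Solver using (module +-*-Solver)
open +-*-Solver using (solve; _:+_; _:*_; _:=_; con)
open import Data.Product using (∃; _×_; _,_; proj₁; proj₂)
open import Data.Product.Properties using () renaming (≡-dec to ×-≡-dec)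
open import Data.Sum using (_⊎_; inj₁; inj₂)
open import Data.Vec using (Vec; []; _∷_; map; head; tail)
open import Data.Vec.Properties using (map-cong; map-id; map-const; ≡-dec) renaming (map-∘ to map-∘ᵛ)
open import Function using (_∘_; const)
open import Function.Bundles using (_⇔_; mk⇔; Equivalence)
open import Function.Construct.Symmetry using (⇔-sym)
open import Relation.Binary.Definitions using (DecidableEquality)
open import Relation.Nullary.Decidable using (Dec; yes; no; map′; does; dec-true; dec-false; ¬?; _×-dec_)
open import Relation.Binary.PropositionalEquality
  using (_≡_; _≢_; refl; sym; trans; cong; cong₂; subst; module ≡-Reasoning)

allVec : ∀ {A : Set} → List A → (n : ℕ) → List (Vec A n)
allVec xs zero    = [] ∷ []
allVec xs (suc n) = cartesianProductWith _∷_ xs (allVec xs n)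

∈-allVec : ∀ {A : Set} {xs : List A} → (∀ a → a ∈ xs) → ∀ {n} (v : Vec A n) → v ∈ allVec xs n
∈-allVec xs-complete []      = here refl
∈-allVec xs-complete (a ∷ v) = ∈-cartesianProductWith⁺ _∷_ (xs-complete a) (∈-allVec xs-complete v)

decidable⇒hasSize : ∀ {A : Set} → DecidableEquality A → (xs : List A) → (∀ x → x ∈ xs) →
                    ∀ {P : A → Set} → Decidable P → ∃ (HasSize P)
decidable⇒hasSize _≟_ xs xs-complete {P} P? =
  length ys , ys , deduplicate-! _≟_ (filter P? xs) , (λ x → mk⇔ (to x) (from x)) , refl
  where
  ys = deduplicate _≟_ (filter P? xs)
  to : ∀ x → x ∈ ys → P x
  to x x∈ys = proj₂ (∈-filter⁻ P? {xs = xs} (∈-deduplicate⁻ _≟_ (filter P? xs) x∈ys))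
  from : ∀ x → P x → x ∈ ys
  from x Px = ∈-deduplicate⁺ _≟_ (∈-filter⁺ P? (xs-complete x) Px)

hasSize-transport : ∀ {A B : Set} {P : A → Set} {Q : B → Set} {k} (f : A → B) (g : B → A) →
                    (∀ x → P x → Q (f x)) → (∀ y → Q y → P (g y)) →
                    (∀ x → P x → g (f x) ≡ x) → (∀ y → Q y → f (g y) ≡ y) →
                    HasSize P k → HasSize Q k
hasSize-transport {P = P} {Q} f g P⇒Qf Q⇒Pg gf≡id fg≡id (xs , xs-unique , xs⇔P , ∣xs∣≡k) =
  List.map f xs , map⁻ (subst Unique (sym g∘f∘xs≡xs) xs-unique) , (λ y → mk⇔ (to y) (from y)) ,
  trans (length-map f xs) ∣xs∣≡k
  where
  g∘f∘xs≡xs : List.map g (List.map f xs) ≡ xs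
  g∘f∘xs≡xs = trans (sym (map-∘ xs))
    (map-id-local (All.tabulate λ {x} x∈xs → gf≡id x (Equivalence.to (xs⇔P x) x∈xs)))
  to : ∀ y → y ∈ List.map f xs → Q y
  to y y∈fxs with ∈-map⁻ f y∈fxs
  ... | x , x∈xs , refl = P⇒Qf x (Equivalence.to (xs⇔P x) x∈xs)
  from : ∀ y → Q y → y ∈ List.map f xs
  from y Qy =
    subst (_∈ List.map f xs) (fg≡id y Qy) (∈-map⁺ f (Equivalence.from (xs⇔P (g y)) (Q⇒Pg y Qy)))

module _ {p : ℕ} .{{_ : NonZero p}} where

  0%p≡0 : 0 % p ≡ 0
  0%p≡0 = m*n%n≡0 0 p

  %-+-absorbʳ : ∀ a b → (a + b % p) % p ≡ (a + b) % p
  %-+-absorbʳ a b = begin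
    (a + b % p) % p           ≡⟨ %-distribˡ-+ a (b % p) p ⟩
    (a % p + b % p % p) % p   ≡⟨ cong (λ r → (a % p + r) % p) (m%n%n≡m%n b p) ⟩
    (a % p + b % p) % p       ≡⟨ %-distribˡ-+ a b p ⟨
    (a + b) % p               ∎
    where open ≡-Reasoning

  %-*-absorbʳ : ∀ a b → (a * (b % p)) % p ≡ (a * b) % p
  %-*-absorbʳ a b = begin
    (a * (b % p)) % p           ≡⟨ %-distribˡ-* a (b % p) p ⟩
    (a % p * (b % p % p)) % p   ≡⟨ cong (λ r → (a % p * r) % p) (m%n%n≡m%n b p) ⟩
    (a % p * (b % p)) % p       ≡⟨ %-distribˡ-* a b p ⟨
    (a * b) % p                 ∎
    where open ≡-Reasoning

  %-*-congˡ : ∀ c {a b} → a % p ≡ b % p → (c * a) % p ≡ (c * b) % p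
  %-*-congˡ c {a} {b} eq = begin
    (c * a) % p         ≡⟨ %-*-absorbʳ c a ⟨
    (c * (a % p)) % p   ≡⟨ cong (λ r → (c * r) % p) eq ⟩
    (c * (b % p)) % p   ≡⟨ %-*-absorbʳ c b ⟩
    (c * b) % p         ∎
    where open ≡-Reasoning

  %-*-congʳ : ∀ c {a b} → a % p ≡ b % p → (a * c) % p ≡ (b * c) % p
  %-*-congʳ c {a} {b} eq rewrite *-comm a c | *-comm b c = %-*-congˡ c eq

  %-*-unitʳ : ∀ a {u} → u % p ≡ 1 % p → (a * u) % p ≡ a % p
  %-*-unitʳ a eq = trans (%-*-congˡ a eq) (cong (_% p) (*-identityʳ a))

  -- In the second Bézout case x * t ≡ -1 (mod p), so (x * t)² ≡ 1.
  coprime⇒%-inverse : ∀ {t} → Coprime t p → ∃ λ s → (s * t) % p ≡ 1 % p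
  coprime⇒%-inverse {t} t⊥p with coprime-Bézout t⊥p
  ... | Bézout.+- x y eq = x , (begin
    (x * t) % p       ≡⟨ cong (_% p) eq ⟨
    (1 + y * p) % p   ≡⟨ [m+kn]%n≡m%n 1 y p ⟩
    1 % p             ∎)
    where open ≡-Reasoning
  ... | Bézout.-+ x y eq = x * (x * t) , (begin
    (x * (x * t) * t) % p               ≡⟨ [m+kn]%n≡m%n _ (2 * y) p ⟨
    (x * (x * t) * t + 2 * y * p) % p   ≡⟨ cong (_% p) square ⟩
    (1 + y * y * p * p) % p             ≡⟨ [m+kn]%n≡m%n 1 (y * y * p) p ⟩
    1 % p                               ∎)
    where
    open ≡-Reasoning
    square : x * (x * t) * t + 2 * y * p ≡ 1 + y * y * p * p
    square = begin
      x * (x * t) * t + 2 * y * p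
        ≡⟨ solve 4 (λ x y t p → x :* (x :* t) :* t :+ con 2 :* y :* p
                              := (x :* t) :* (x :* t) :+ con 2 :* (y :* p)) refl x y t p ⟩
      (x * t) * (x * t) + 2 * (y * p)
        ≡⟨ cong (λ r → (x * t) * (x * t) + 2 * r) eq ⟨
      (x * t) * (x * t) + 2 * (1 + x * t)
        ≡⟨ solve 1 (λ z → z :* z :+ con 2 :* (con 1 :+ z)
                        := con 1 :+ (con 1 :+ z) :* (con 1 :+ z)) refl (x * t) ⟩
      1 + (1 + x * t) * (1 + x * t)
        ≡⟨ cong (λ r → 1 + r * r) eq ⟩
      1 + (y * p) * (y * p)
        ≡⟨ solve 2 (λ y p → con 1 :+ (y :* p) :* (y :* p) := con 1 :+ y :* y :* p :* p) refl y p ⟩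
      1 + y * y * p * p
        ∎

  %-*-cancelʳ : ∀ {t k l} → Coprime t p → (k * t) % p ≡ (l * t) % p → k % p ≡ l % p
  %-*-cancelʳ {t} {k} {l} t⊥p eq = begin
    k % p             ≡⟨ %-*-unitʳ k t*s≡1 ⟨
    (k * (t * s)) % p ≡⟨ cong (_% p) (*-assoc k t s) ⟨
    (k * t * s) % p   ≡⟨ %-*-congʳ s eq ⟩
    (l * t * s) % p   ≡⟨ cong (_% p) (*-assoc l t s) ⟩
    (l * (t * s)) % p ≡⟨ %-*-unitʳ l t*s≡1 ⟩
    l % p             ∎
    where
    open ≡-Reasoning
    s = proj₁ (coprime⇒%-inverse t⊥p)
    t*s≡1 : (t * s) % p ≡ 1 % p
    t*s≡1 = trans (cong (_% p) (*-comm t s)) (proj₂ (coprime⇒%-inverse t⊥p))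

chinese-remainder : ∀ {p q} .{{_ : NonZero p}} .{{_ : NonZero q}} → Coprime p q →
                    ∀ i j → ∃ λ k → k % p ≡ i % p × k % q ≡ j % q
chinese-remainder {p} {q} p⊥q i j = i * (s * q) + j * (r * p) , k≡i , k≡j
  where
  open ≡-Reasoning
  s = proj₁ (coprime⇒%-inverse (coprime-sym p⊥q))
  r = proj₁ (coprime⇒%-inverse p⊥q)
  s*q≡1 : (s * q) % p ≡ 1 % p
  s*q≡1 = proj₂ (coprime⇒%-inverse (coprime-sym p⊥q))
  r*p≡1 : (r * p) % q ≡ 1 % q
  r*p≡1 = proj₂ (coprime⇒%-inverse p⊥q)
  k≡i : (i * (s * q) + j * (r * p)) % p ≡ i % p
  k≡i = begin
    (i * (s * q) + j * (r * p)) % p ≡⟨ cong (λ z → (i * (s * q) + z) % p) (*-assoc j r p) ⟨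
    (i * (s * q) + j * r * p) % p   ≡⟨ [m+kn]%n≡m%n _ (j * r) p ⟩
    (i * (s * q)) % p               ≡⟨ %-*-unitʳ i s*q≡1 ⟩
    i % p                           ∎
  k≡j : (i * (s * q) + j * (r * p)) % q ≡ j % q
  k≡j = begin
    (i * (s * q) + j * (r * p)) % q ≡⟨ cong (_% q) (+-comm (i * (s * q)) _) ⟩
    (j * (r * p) + i * (s * q)) % q ≡⟨ cong (λ z → (j * (r * p) + z) % q) (*-assoc i s q) ⟨
    (j * (r * p) + i * s * q) % q   ≡⟨ [m+kn]%n≡m%n _ (i * s) q ⟩
    (j * (r * p)) % q               ≡⟨ %-*-unitʳ j r*p≡1 ⟩
    j % q                           ∎

prime⇒1<p : ∀ {p} → Prime p → 1 < p
prime⇒1<p {p} pp = nonTrivial⇒n>1 p {{prime⇒nonTrivial pp}}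

%≢0⇒coprime : ∀ {p t} (pp : Prime p) → (t % p) {{prime⇒nonZero pp}} ≢ 0 → Coprime t p
%≢0⇒coprime {p} {t} pp t%p≢0 (d∣t , d∣p) with prime⇒irreducible pp d∣p
... | inj₁ d≡1 = d≡1
... | inj₂ refl = ⊥-elim (t%p≢0 (n∣m⇒m%n≡0 t p {{prime⇒nonZero pp}} d∣t))

distinct-primes⇒coprime : ∀ {p q} → Prime p → Prime q → p ≢ q → Coprime p q
distinct-primes⇒coprime pp pq p≢q (d∣p , d∣q) with prime⇒irreducible pp d∣p
... | inj₁ d≡1 = d≡1
... | inj₂ refl with prime⇒irreducible pq d∣q
...   | inj₁ refl = ⊥-elim (<-irrefl refl (prime⇒1<p pp))
...   | inj₂ p≡q = ⊥-elim (p≢q p≡q)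

module _ {p : ℕ} .{{_ : NonZero p}} where

  [_] : ℕ → Fin p
  [ k ] = fromℕ< (m%n<n k p)

  toℕ-[] : ∀ k → toℕ [ k ] ≡ k % p
  toℕ-[] k = toℕ-fromℕ< (m%n<n k p)

  []-cong : ∀ {k l} → k % p ≡ l % p → [ k ] ≡ [ l ]
  []-cong {k} {l} eq = fromℕ<-cong _ _ eq (m%n<n k p) (m%n<n l p)

  []-injective : ∀ {k l} → [ k ] ≡ [ l ] → k % p ≡ l % p
  []-injective {k} {l} = fromℕ<-injective _ _ (m%n<n k p) (m%n<n l p)

  []-toℕ : ∀ t → [ toℕ t ] ≡ t
  []-toℕ t = trans (fromℕ<-cong _ _ (m<n⇒m%n≡m (toℕ<n t)) _ (toℕ<n t)) (fromℕ<-toℕ t (toℕ<n t))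

  infixr 7 _•ₚ_
  _•ₚ_ : ℕ → Fin p → Fin p
  k •ₚ t = [ k * toℕ t ]

  •ₚ-cong : ∀ {k l} t → k % p ≡ l % p → k •ₚ t ≡ l •ₚ t
  •ₚ-cong t eq = []-cong (%-*-congʳ (toℕ t) eq)

  •ₚ-assoc : ∀ k l t → k •ₚ (l •ₚ t) ≡ (k * l) •ₚ t
  •ₚ-assoc k l t = []-cong (begin
    (k * toℕ [ l * toℕ t ]) % p ≡⟨ cong (λ r → (k * r) % p) (toℕ-[] (l * toℕ t)) ⟩
    (k * ((l * toℕ t) % p)) % p ≡⟨ %-*-absorbʳ k (l * toℕ t) ⟩
    (k * (l * toℕ t)) % p       ≡⟨ cong (_% p) (*-assoc k l (toℕ t)) ⟨
    (k * l * toℕ t) % p         ∎)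
    where open ≡-Reasoning

  •ₚ-identityˡ : ∀ t → 1 •ₚ t ≡ t
  •ₚ-identityˡ t = trans (cong [_] (*-identityˡ (toℕ t))) ([]-toℕ t)

  +ₚ-•ₚ : ∀ k t → t +ₚ (k •ₚ t) ≡ suc k •ₚ t
  +ₚ-•ₚ k t = []-cong (trans (cong (λ r → (toℕ t + r) % p) (toℕ-[] (k * toℕ t)))
                             (%-+-absorbʳ (toℕ t) (k * toℕ t)))

  •ₚ-cancelʳ : ∀ {k l t} → Prime p → t ≢ [ 0 ] → k •ₚ t ≡ l •ₚ t → k % p ≡ l % p
  •ₚ-cancelʳ {k} {l} {t} pp t≢0 eq =
    %-*-cancelʳ (%≢0⇒coprime pp toℕt%p≢0) ([]-injective eq)
    where
    toℕt%p≢0 : toℕ t % p ≢ 0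
    toℕt%p≢0 t%p≡0 = t≢0 (trans (sym ([]-toℕ t)) ([]-cong (trans t%p≡0 (sym 0%p≡0))))

module ElementaryAbelian {p : ℕ} (pp : Prime p) where

  private instance
    p≢0 : NonZero p
    p≢0 = prime⇒nonZero pp

  0v : ∀ {n} → El p n
  0v = elId pp

  infixr 7 _•_
  _•_ : ∀ {n} → ℕ → El p n → El p n
  k • x = map (k •ₚ_) x

  •-cong : ∀ {n k l} (x : El p n) → k % p ≡ l % p → k • x ≡ l • x
  •-cong x eq = map-cong (λ t → •ₚ-cong t eq) x

  •-assoc : ∀ {n} k l (x : El p n) → k • (l • x) ≡ (k * l) • x
  •-assoc k l x = trans (sym (map-∘ᵛ _ _ x)) (map-cong (•ₚ-assoc k l) x)

  •-identityˡ : ∀ {n} (x : El p n) → 1 • x ≡ x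
  •-identityˡ x = trans (map-cong •ₚ-identityˡ x) (map-id x)

  •-zeroˡ : ∀ {n} (x : El p n) → 0 • x ≡ 0v
  •-zeroˡ x = map-const x [ 0 ]

  •-suc : ∀ {n} k (x : El p n) → elAdd pp x (k • x) ≡ suc k • x
  •-suc k []      = refl
  •-suc k (t ∷ x) = cong₂ _∷_ (+ₚ-•ₚ k t) (•-suc k x)

  •-cancelʳ : ∀ {n k l} (x : El p n) → x ≢ 0v → k • x ≡ l • x → k % p ≡ l % p
  •-cancelʳ []      x≢0 _  = ⊥-elim (x≢0 refl)
  •-cancelʳ (t ∷ x) x≢0 eq with t ≟ᶠ [ 0 ]
  ... | no t≢0   = •ₚ-cancelʳ pp t≢0 (cong head eq)
  ... | yes refl = •-cancelʳ x (x≢0 ∘ cong ([ 0 ] ∷_)) (cong tail eq)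

  nonzero-exists : ∀ {n} → 1 ≤ n → ∃ λ (x : El p n) → x ≢ 0v
  nonzero-exists (s≤s z≤n) = [ 1 ] ∷ 0v , λ eq → 1≢0 ([]-injective (cong head eq))
    where
    1≢0 : 1 % p ≢ 0 % p
    1≢0 eq with trans (sym (m<n⇒m%n≡m (prime⇒1<p pp))) (trans eq 0%p≡0)
    ... | ()

  module _ {n : ℕ} where

    infix 4 _≟_
    _≟_ : DecidableEquality (El p n)
    _≟_ = ≡-dec _≟ᶠ_

    _∈⟨_⟩ : El p n → El p n → Set
    x ∈⟨ a ⟩ = ∃ λ k → k • a ≡ x

    Cocyclic : El p n → El p n → Set
    Cocyclic a x = ∃ λ y → a ∈⟨ y ⟩ × x ∈⟨ y ⟩

    -- The search ranges over Fin p, which suffices because k • a only depends on k % p.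
    _∈⟨_⟩? : ∀ x a → Dec (x ∈⟨ a ⟩)
    x ∈⟨ a ⟩? = map′ (λ (t , e) → toℕ t , e) (λ (k , e) → [ k ] , trans (•-cong a (reduce k)) e)
                     (any? λ t → toℕ t • a ≟ x)
      where
      reduce : ∀ k → toℕ {p} [ k ] % p ≡ k % p
      reduce k = trans (cong (_% p) (toℕ-[] k)) (m%n%n≡m%n k p)

    0v-cocyclic : ∀ {x} → Cocyclic 0v x
    0v-cocyclic {x} = x , (0 , •-zeroˡ x) , (1 , •-identityˡ x)

    ∈⟨⟩⇒cocyclic : ∀ {a x} → x ∈⟨ a ⟩ → Cocyclic a x
    ∈⟨⟩⇒cocyclic {a} x∈⟨a⟩ = a , (1 , •-identityˡ a) , x∈⟨a⟩

    cocyclic⇒∈⟨⟩ : ∀ {a x} → a ≢ 0v → Cocyclic a x → x ∈⟨ a ⟩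
    cocyclic⇒∈⟨⟩ a≢0 (y , (i , refl) , (j , refl)) = j * s , (begin
      (j * s) • (i • y) ≡⟨ •-assoc (j * s) i y ⟩
      (j * s * i) • y   ≡⟨ •-cong y (trans (cong (_% p) (*-assoc j s i)) (%-*-unitʳ j s*i≡1)) ⟩
      j • y             ∎)
      where
      open ≡-Reasoning
      i%p≢0 : i % p ≢ 0
      i%p≢0 i%p≡0 = a≢0 (trans (•-cong y (trans i%p≡0 (sym 0%p≡0))) (•-zeroˡ y))
      s = proj₁ (coprime⇒%-inverse (%≢0⇒coprime pp i%p≢0))
      s*i≡1 : (s * i) % p ≡ 1 % p
      s*i≡1 = proj₂ (coprime⇒%-inverse (%≢0⇒coprime pp i%p≢0))

    cocyclic? : ∀ a x → Dec (Cocyclic a x)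
    cocyclic? a x with a ≟ 0v
    ... | yes refl = yes 0v-cocyclic
    ... | no a≢0   = map′ ∈⟨⟩⇒cocyclic (cocyclic⇒∈⟨⟩ a≢0) (x ∈⟨ a ⟩?)

    _≈₀_ : El p n → El p n → Set
    a ≈₀ a′ = a ≡ 0v ⇔ a′ ≡ 0v

    ≈₀-cases : ∀ {a a′} → a ≈₀ a′ → (a ≡ 0v × a′ ≡ 0v) ⊎ (a ≢ 0v × a′ ≢ 0v)
    ≈₀-cases {a} a≈₀a′ with a ≟ 0v
    ... | yes a≡0 = inj₁ (a≡0 , Equivalence.to a≈₀a′ a≡0)
    ... | no a≢0  = inj₂ (a≢0 , a≢0 ∘ Equivalence.from a≈₀a′)

    ≡0v⇒≈₀ : ∀ {a a′} → a ≡ 0v → a′ ≡ 0v → a ≈₀ a′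
    ≡0v⇒≈₀ a≡0 a′≡0 = mk⇔ (const a′≡0) (const a≡0)

    ≢0v⇒≈₀ : ∀ {a a′} → a ≢ 0v → a′ ≢ 0v → a ≈₀ a′
    ≢0v⇒≈₀ a≢0 a′≢0 = mk⇔ (⊥-elim ∘ a≢0) (⊥-elim ∘ a′≢0)

    lineMap : El p n → El p n → El p n → El p n
    lineMap a a′ x with x ∈⟨ a ⟩?
    ... | yes (k , _) = k • a′
    ... | no _        = x

    lineMap-0v : ∀ x → lineMap 0v 0v x ≡ x
    lineMap-0v x with x ∈⟨ 0v ⟩?
    ... | yes (_ , k•0≡x) = k•0≡x
    ... | no _            = refl

    lineMap-∈⟨⟩ : ∀ {a a′ x} k → a ≢ 0v → k • a ≡ x → lineMap a a′ x ≡ k • a′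
    lineMap-∈⟨⟩ {a} {a′} {x} k a≢0 k•a≡x with x ∈⟨ a ⟩?
    ... | yes (l , l•a≡x) = •-cong a′ (•-cancelʳ {k = l} {l = k} a a≢0 (trans l•a≡x (sym k•a≡x)))
    ... | no x∉⟨a⟩        = ⊥-elim (x∉⟨a⟩ (k , k•a≡x))

    lineMap-fixes-0v : ∀ {a a′} → a ≈₀ a′ → lineMap a a′ 0v ≡ 0v
    lineMap-fixes-0v a≈₀a′ with ≈₀-cases a≈₀a′
    ... | inj₁ (refl , refl) = lineMap-0v 0v
    ... | inj₂ (a≢0 , _)     = trans (lineMap-∈⟨⟩ 0 a≢0 (•-zeroˡ _)) (•-zeroˡ _)

    lineMap-base : ∀ {a a′} → a ≈₀ a′ → lineMap a a′ a ≡ a′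
    lineMap-base a≈₀a′ with ≈₀-cases a≈₀a′
    ... | inj₁ (refl , refl) = lineMap-0v 0v
    ... | inj₂ (a≢0 , _)     = trans (lineMap-∈⟨⟩ 1 a≢0 (•-identityˡ _)) (•-identityˡ _)

    lineMap-cocyclic : ∀ {a a′ x} → a ≈₀ a′ → Cocyclic a x → Cocyclic a′ (lineMap a a′ x)
    lineMap-cocyclic a≈₀a′ a~x with ≈₀-cases a≈₀a′
    ... | inj₁ (refl , refl) = 0v-cocyclic
    ... | inj₂ (a≢0 , _) with cocyclic⇒∈⟨⟩ a≢0 a~x
    ...   | k , k•a≡x = ∈⟨⟩⇒cocyclic (k , sym (lineMap-∈⟨⟩ k a≢0 k•a≡x))

    lineMap-inverse : ∀ {a a′ x} → a ≈₀ a′ → Cocyclic a x → lineMap a′ a (lineMap a a′ x) ≡ x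
    lineMap-inverse {x = x} a≈₀a′ a~x with ≈₀-cases a≈₀a′
    ... | inj₁ (refl , refl) = trans (lineMap-0v _) (lineMap-0v x)
    ... | inj₂ (a≢0 , a′≢0) with cocyclic⇒∈⟨⟩ a≢0 a~x
    ...   | k , k•a≡x = trans (cong (lineMap _ _) (lineMap-∈⟨⟩ k a≢0 k•a≡x))
                              (trans (lineMap-∈⟨⟩ k a′≢0 refl) k•a≡x)

    lineMap-reflect : ∀ {a a′ x y} → a ≈₀ a′ → Cocyclic a x → lineMap a a′ x ≡ y → x ≡ lineMap a′ a y
    lineMap-reflect a≈₀a′ a~x refl = sym (lineMap-inverse a≈₀a′ a~x)

    lineMap-≈₀ : ∀ {a a′ x} → a ≈₀ a′ → Cocyclic a x → x ≈₀ lineMap a a′ x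
    lineMap-≈₀ a≈₀a′ a~x = mk⇔ (λ { refl → lineMap-fixes-0v a≈₀a′ })
      (λ φx≡0 → trans (lineMap-reflect a≈₀a′ a~x φx≡0) (lineMap-fixes-0v (⇔-sym a≈₀a′)))

    lineMap-reflects-base : ∀ {a a′ x} → a ≈₀ a′ → Cocyclic a x → lineMap a a′ x ≡ a′ → x ≡ a
    lineMap-reflects-base a≈₀a′ a~x φx≡a′ =
      trans (lineMap-reflect a≈₀a′ a~x φx≡a′) (lineMap-base (⇔-sym a≈₀a′))

module DirectProduct {p q n m : ℕ} (pp : Prime p) (pq : Prime q) where

  module P = ElementaryAbelian pp
  module Q = ElementaryAbelian pq
  open P using (_∈⟨_⟩; Cocyclic)

  private instance
    p≢0 : NonZero p
    p≢0 = prime⇒nonZero pp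
    q≢0 : NonZero q
    q≢0 = prime⇒nonZero pq

  pow-• : ∀ (x : El p n) (y : El q m) k → pow pp pq (x , y) k ≡ (k P.• x , k Q.• y)
  pow-• x y zero    = sym (cong₂ _,_ (P.•-zeroˡ x) (Q.•-zeroˡ y))
  pow-• x y (suc k) = trans (cong (_·_ pp pq (x , y)) (pow-• x y k))
                            (cong₂ _,_ (P.•-suc k x) (Q.•-suc k y))

  InCyclic⇒∈⟨⟩ : ∀ {a b x y} → InCyclic pp pq (a , b) (x , y) → a ∈⟨ x ⟩ × b Q.∈⟨ y ⟩
  InCyclic⇒∈⟨⟩ {x = x} {y} (k , eq) = (k , cong proj₁ eq′) , (k , cong proj₂ eq′)
    where eq′ = trans (sym (pow-• x y k)) eq

  ∈⟨⟩⇒InCyclic : p ≢ q → ∀ {a b x y} → a ∈⟨ x ⟩ → b Q.∈⟨ y ⟩ → InCyclic pp pq (a , b) (x , y)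
  ∈⟨⟩⇒InCyclic p≢q {x = x} {y} (i , i•x≡a) (j , j•y≡b)
    with chinese-remainder (distinct-primes⇒coprime pp pq p≢q) i j
  ... | k , k≡i , k≡j =
    k , trans (pow-• x y k) (cong₂ _,_ (trans (P.•-cong x k≡i) i•x≡a) (trans (Q.•-cong y k≡j) j•y≡b))

  Adj⇒cocyclic : ∀ {a b x y} → Adj pp pq (a , b) (x , y) → Cocyclic a x × Q.Cocyclic b y
  Adj⇒cocyclic (_ , (c , d) , ab∈⟨cd⟩ , xy∈⟨cd⟩)
    with InCyclic⇒∈⟨⟩ ab∈⟨cd⟩ | InCyclic⇒∈⟨⟩ xy∈⟨cd⟩
  ... | a∈⟨c⟩ , b∈⟨d⟩ | x∈⟨c⟩ , y∈⟨d⟩ = (c , a∈⟨c⟩ , x∈⟨c⟩) , (d , b∈⟨d⟩ , y∈⟨d⟩)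

  cocyclic⇒Adj : p ≢ q → ∀ {a b x y} → (a , b) ≢ (x , y) → Cocyclic a x → Q.Cocyclic b y →
                 Adj pp pq (a , b) (x , y)
  cocyclic⇒Adj p≢q ab≢xy (c , a∈⟨c⟩ , x∈⟨c⟩) (d , b∈⟨d⟩ , y∈⟨d⟩) =
    ab≢xy , (c , d) , ∈⟨⟩⇒InCyclic p≢q a∈⟨c⟩ b∈⟨d⟩ , ∈⟨⟩⇒InCyclic p≢q x∈⟨c⟩ y∈⟨d⟩

module EquitablePartition {p q n m : ℕ} (pp : Prime p) (pq : Prime q) (p≢q : p ≢ q) where

  open DirectProduct {n = n} {m = m} pp pq
  open P using (_≈₀_)
  open Equivalence using (to; from)

  Vertex : Set
  Vertex = G p n q m

  Adjacent : Vertex → Vertex → Set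
  Adjacent = Adj pp pq

  Part : Fin 4 → Vertex → Set
  Part = V pp pq

  _≟ᴳ_ : DecidableEquality Vertex
  _≟ᴳ_ = ×-≡-dec P._≟_ Q._≟_

  part-code : Bool → Bool → Fin 4
  part-code true  true  = fz
  part-code false true  = fs fz
  part-code false false = fs (fs fz)
  part-code true  false = fs (fs (fs fz))

  part : Vertex → Fin 4
  part (a , b) = part-code (does (a P.≟ P.0v)) (does (b Q.≟ Q.0v))

  Part-part : ∀ w → Part (part w) w
  Part-part (a , b) with a P.≟ P.0v | b Q.≟ Q.0v
  ... | yes a≡0 | yes b≡0 = a≡0 , b≡0
  ... | no a≢0  | yes b≡0 = a≢0 , b≡0
  ... | no a≢0  | no b≢0  = a≢0 , b≢0
  ... | yes a≡0 | no b≢0  = a≡0 , b≢0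

  Part⇒part : ∀ i w → Part i w → part w ≡ i
  Part⇒part fz                (a , b) (a≡0 , b≡0) = cong₂ part-code (dec-true (a P.≟ _) a≡0) (dec-true (b Q.≟ _) b≡0)
  Part⇒part (fs fz)           (a , b) (a≢0 , b≡0) = cong₂ part-code (dec-false (a P.≟ _) a≢0) (dec-true (b Q.≟ _) b≡0)
  Part⇒part (fs (fs fz))      (a , b) (a≢0 , b≢0) = cong₂ part-code (dec-false (a P.≟ _) a≢0) (dec-false (b Q.≟ _) b≢0)
  Part⇒part (fs (fs (fs fz))) (a , b) (a≡0 , b≢0) = cong₂ part-code (dec-true (a P.≟ _) a≡0) (dec-false (b Q.≟ _) b≢0)

  Part-disjoint : ∀ i j w → Part i w → Part j w → i ≡ j
  Part-disjoint i j w Viw Vjw = trans (sym (Part⇒part i w Viw)) (Part⇒part j w Vjw)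

  Part? : ∀ j w → Dec (Part j w)
  Part? j w =
    map′ (λ part≡j → subst (λ i → Part i w) part≡j (Part-part w)) (Part⇒part j w) (part w ≟ᶠ j)

  Part-nonempty : 1 ≤ n → 1 ≤ m → ∀ i → ∃ (Part i)
  Part-nonempty n≥1 m≥1 i with P.nonzero-exists n≥1 | Q.nonzero-exists m≥1
  ... | a , a≢0 | b , b≢0 with i
  ...   | fz                = (P.0v , Q.0v) , refl , refl
  ...   | fs fz             = (a , Q.0v) , a≢0 , refl
  ...   | fs (fs fz)        = (a , b) , a≢0 , b≢0
  ...   | fs (fs (fs fz))   = (P.0v , b) , refl , b≢0

  Part-≈₀ : ∀ i {a a′ : El p n} {b b′ : El q m} →
            Part i (a , b) → Part i (a′ , b′) → a ≈₀ a′ × b Q.≈₀ b′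
  Part-≈₀ fz                (a≡0 , b≡0) (a′≡0 , b′≡0) = P.≡0v⇒≈₀ a≡0 a′≡0 , Q.≡0v⇒≈₀ b≡0 b′≡0
  Part-≈₀ (fs fz)           (a≢0 , b≡0) (a′≢0 , b′≡0) = P.≢0v⇒≈₀ a≢0 a′≢0 , Q.≡0v⇒≈₀ b≡0 b′≡0
  Part-≈₀ (fs (fs fz))      (a≢0 , b≢0) (a′≢0 , b′≢0) = P.≢0v⇒≈₀ a≢0 a′≢0 , Q.≢0v⇒≈₀ b≢0 b′≢0
  Part-≈₀ (fs (fs (fs fz))) (a≡0 , b≢0) (a′≡0 , b′≢0) = P.≡0v⇒≈₀ a≡0 a′≡0 , Q.≢0v⇒≈₀ b≢0 b′≢0

  Part-resp-≈₀ : ∀ j {x x′ : El p n} {y y′ : El q m} →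
                 x ≈₀ x′ → y Q.≈₀ y′ → Part j (x , y) → Part j (x′ , y′)
  Part-resp-≈₀ fz                x≈₀x′ y≈₀y′ (x≡0 , y≡0) = to x≈₀x′ x≡0 , to y≈₀y′ y≡0
  Part-resp-≈₀ (fs fz)           x≈₀x′ y≈₀y′ (x≢0 , y≡0) = x≢0 ∘ from x≈₀x′ , to y≈₀y′ y≡0
  Part-resp-≈₀ (fs (fs fz))      x≈₀x′ y≈₀y′ (x≢0 , y≢0) = x≢0 ∘ from x≈₀x′ , y≢0 ∘ from y≈₀y′
  Part-resp-≈₀ (fs (fs (fs fz))) x≈₀x′ y≈₀y′ (x≡0 , y≢0) = to x≈₀x′ x≡0 , y≢0 ∘ from y≈₀y′

  Adjacent? : ∀ u w → Dec (Adjacent u w)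
  Adjacent? (a , b) (x , y) =
    map′ (λ (ab≢xy , a~x , b~y) → cocyclic⇒Adj p≢q ab≢xy a~x b~y) (λ adj → proj₁ adj , Adj⇒cocyclic adj)
         (¬? ((a , b) ≟ᴳ (x , y)) ×-dec P.cocyclic? a x ×-dec Q.cocyclic? b y)

  Neighbour : Vertex → Fin 4 → Vertex → Set
  Neighbour u j w = Adjacent u w × Part j w

  neighbours-hasSize : ∀ u j → ∃ (HasSize (Neighbour u j))
  neighbours-hasSize u j =
    decidable⇒hasSize _≟ᴳ_ vertices ∈-vertices (λ w → Adjacent? u w ×-dec Part? j w)
    where
    vertices : List Vertex
    vertices = cartesianProduct (allVec (allFin p) n) (allVec (allFin q) m)
    ∈-vertices : ∀ w → w ∈ vertices
    ∈-vertices (a , b) = ∈-cartesianProduct⁺ (∈-allVec ∈-allFin a) (∈-allVec ∈-allFin b)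

  neighbourMap : Vertex → Vertex → Vertex → Vertex
  neighbourMap (a , b) (a′ , b′) (x , y) = P.lineMap a a′ x , Q.lineMap b b′ y

  module _ {a a′ : El p n} {b b′ : El q m} (a≈₀a′ : a ≈₀ a′) (b≈₀b′ : b Q.≈₀ b′) where

    neighbourMap-Neighbour : ∀ {j} w → Neighbour (a , b) j w →
                             Neighbour (a′ , b′) j (neighbourMap (a , b) (a′ , b′) w)
    neighbourMap-Neighbour {j} (x , y) (adj , Vjw) with Adj⇒cocyclic adj
    ... | a~x , b~y =
      cocyclic⇒Adj p≢q distinct (P.lineMap-cocyclic a≈₀a′ a~x) (Q.lineMap-cocyclic b≈₀b′ b~y) ,
      Part-resp-≈₀ j (P.lineMap-≈₀ a≈₀a′ a~x) (Q.lineMap-≈₀ b≈₀b′ b~y) Vjw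
      where
      distinct : (a′ , b′) ≢ (P.lineMap a a′ x , Q.lineMap b b′ y)
      distinct eq = proj₁ adj (cong₂ _,_ (sym (P.lineMap-reflects-base a≈₀a′ a~x (sym (cong proj₁ eq))))
                                         (sym (Q.lineMap-reflects-base b≈₀b′ b~y (sym (cong proj₂ eq)))))

    neighbourMap-inverse : ∀ {j} w → Neighbour (a , b) j w →
                           neighbourMap (a′ , b′) (a , b) (neighbourMap (a , b) (a′ , b′) w) ≡ w
    neighbourMap-inverse (x , y) (adj , _) with Adj⇒cocyclic adj
    ... | a~x , b~y = cong₂ _,_ (P.lineMap-inverse a≈₀a′ a~x) (Q.lineMap-inverse b≈₀b′ b~y)

  neighbours-equinumerous : ∀ i j u v {k} → Part i u → Part i v →
                            HasSize (Neighbour u j) k → HasSize (Neighbour v j) k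
  neighbours-equinumerous i j (a , b) (a′ , b′) Viu Viv with Part-≈₀ i Viu Viv
  ... | a≈₀a′ , b≈₀b′ = hasSize-transport (neighbourMap (a , b) (a′ , b′)) (neighbourMap (a′ , b′) (a , b))
    (neighbourMap-Neighbour a≈₀a′ b≈₀b′) (neighbourMap-Neighbour (⇔-sym a≈₀a′) (⇔-sym b≈₀b′))
    (neighbourMap-inverse a≈₀a′ b≈₀b′) (neighbourMap-inverse (⇔-sym a≈₀a′) (⇔-sym b≈₀b′))

lemma4p11 : (p q n m : ℕ) → (pp : Prime p) → (pq : Prime q) → p ≢ q →
            1 ≤ n → 1 ≤ m →
            IsEquitable (Adj {p} {n} {q} {m} pp pq) (V {p} {n} {q} {m} pp pq)
lemma4p11 p q n m pp pq p≢q n≥1 m≥1 =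
  (Part-nonempty n≥1 m≥1 , (λ w → part w , Part-part w) , Part-disjoint) ,
  λ i j u v Viu Viv → let k , Nu = neighbours-hasSize u j
                      in k , Nu , neighbours-equinumerous i j u v Viu Viv Nu
  where open EquitablePartition {n = n} {m = m} pp pq p≢q
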